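{- Let $G$ be a self-complementary pseudo-split graph with a pseudo-split partition $K\uplus I\uplus C$. If $C\neq\emptyset$, then $G-C$ is a self-complementary split graph of even order.
   Context: Graphs are finite and simple. A graph is self-complementary if it is isomorphic to its complement. A split graph is a graph whose vertex set can be partitioned into a clique and an independent set. A pseudo-split partition of a graph $G$ is a partition $V(G)=K\uplus I\uplus C$ where $K$ is a clique, $I$ an independent set, and $C$ is either empty or a set of five vertices that induces a 5-cycle, is complete to $K$ (every vertex of $C$ adjacent to every vertex of $K$) and has no edges to $I$. A pseudo-split graph is a graph admitting a pseudo-split partition. $G-C$ denotes the subgraph induced by $V(G)\setminus C$. -}

module Defs where

open import Data.Nat using (ℕ; _*_)
open import Data.Fin using (Fin; zero; suc)
open import Data.Product using (Σ; ∃; _×_; _,_; proj₁)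
open import Data.Sum using (_⊎_)
open import Data.Empty using (⊥)
open import Data.Bool using (Bool; true; false)
open import Relation.Nullary using (¬_)
open import Relation.Binary.PropositionalEquality as Eq using (_≡_; _≢_; refl)
open import Function.Bundles using (_⤖_; _⇔_; Bijection)
open import Function.Definitions using (Injective)

record Graph (V : Set) : Set₁ where
  field
    Adj    : V → V → Set
    sym    : ∀ {u v} → Adj u v → Adj v u
    irrefl : ∀ {v} → ¬ Adj v v
open Graph public

complement : ∀ {V} → Graph V → Graph V
complement G = record
  { Adj    = λ u v → u ≢ v × ¬ Adj G u v
  ; sym    = λ { (u≢v , ¬a) → (λ e → u≢v (Eq.sym e)) , (λ a → ¬a (Graph.sym G a)) }
  ; irrefl = λ { (v≢v , _) → v≢v refl }
  }

_≅_ : ∀ {V W} → Graph V → Graph W → Set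
_≅_ {V} {W} G H =
  Σ (V ⤖ W) λ f → ∀ u v → Adj G u v ⇔ Adj H (Bijection.to f u) (Bijection.to f v)

SelfComplementary : ∀ {V} → Graph V → Set
SelfComplementary G = G ≅ complement G

IsClique : ∀ {V} → Graph V → (V → Set) → Set
IsClique G S = ∀ u v → S u → S v → u ≢ v → Adj G u v

IsIndependent : ∀ {V} → Graph V → (V → Set) → Set
IsIndependent G S = ∀ u v → S u → S v → ¬ Adj G u v

IsSplit : ∀ {V} → Graph V → Set₁
IsSplit {V} G =
  Σ (V → Set) λ K → Σ (V → Set) λ I →
    (∀ v → K v ⊎ I v) × (∀ v → K v → I v → ⊥) × IsClique G K × IsIndependent G I

suc5 : Fin 5 → Fin 5
suc5 zero = suc zero
suc5 (suc zero) = suc (suc zero)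
suc5 (suc (suc zero)) = suc (suc (suc zero))
suc5 (suc (suc (suc zero))) = suc (suc (suc (suc zero)))
suc5 (suc (suc (suc (suc zero)))) = zero

InducesC5 : ∀ {V} → Graph V → (V → Set) → Set
InducesC5 {V} G S =
  Σ (Fin 5 → V) λ c →
    Injective _≡_ _≡_ c ×
    (∀ v → S v ⇔ (∃ λ i → c i ≡ v)) ×
    (∀ i j → Adj G (c i) (c j) ⇔ (j ≡ suc5 i ⊎ i ≡ suc5 j))

-- Part labels: a function V → Part is exactly a partition of V into three parts.
data Part : Set where
  inK inI inC : Part

In : ∀ {V : Set} → (V → Part) → Part → V → Set
In part p v = part v ≡ p

record PseudoSplitPartition {V : Set} (G : Graph V) : Set where
  field
    part             : V → Part
    K-clique         : IsClique G (In part inK)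
    I-independent    : IsIndependent G (In part inI)
    C-shape          : (∀ v → ¬ In part inC v) ⊎ InducesC5 G (In part inC)
    C-complete-K     : ∀ u v → In part inC u → In part inK v → Adj G u v
    C-anticomplete-I : ∀ u v → In part inC u → In part inI v → ¬ Adj G u v

IsPseudoSplit : ∀ {V} → Graph V → Set
IsPseudoSplit G = PseudoSplitPartition G

-- G - C : the subgraph induced by V ∖ C.
-- Membership in C as a Bool test (so that proofs of "v ∉ C" are unique, being
-- equalities in Bool).
isC : Part → Bool
isC inC = true
isC inK = false
isC inI = false

DeleteC : ∀ {V} {G : Graph V} → PseudoSplitPartition G → Set
DeleteC {V} P = Σ V λ v → isC (PseudoSplitPartition.part P v) ≡ false

minusC : ∀ {V} (G : Graph V) (P : PseudoSplitPartition G) → Graph (DeleteC P)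
minusC G P = record
  { Adj    = λ u v → Adj G (proj₁ u) (proj₁ v)
  ; sym    = Graph.sym G
  ; irrefl = Graph.irrefl G
  }

HasOrder : Set → ℕ → Set
HasOrder V m = V ⤖ Fin m

HasEvenOrder : Set → Set
HasEvenOrder V = ∃ λ k → HasOrder V (2 * k)

{-# OPTIONS --safe #-}
-- Let σ : G ≅ complement G and let C = {c₀, …, c₄} be the 5-cycle. Then σ(cᵢ) and σ(cⱼ) are
-- adjacent exactly when i and j are two apart. If σ(cᵢ) were in K, then σ(cᵢ₋₁) and σ(cᵢ₊₁), being
-- non-adjacent to it, would lie in I although they are adjacent; if σ(cᵢ) were in I, then σ(cᵢ₊₂),
-- which is adjacent to it, could lie neither in I nor in K nor in C. Hence σ(C) ⊆ C, and since σ is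
-- injective and C finite, σ also maps V ∖ C into itself: σ restricts to an isomorphism of G − C with
-- its complement, while K and I split G − C.
-- On V ∖ C, σ has no fixed point (compare the adjacency of u and σ(c₀) with that of c₀ and u), and
-- adjacency between consecutive vertices of a σ-orbit alternates, so every σ-orbit in V ∖ C has
-- even length. Sending each vertex halfway around its orbit is a fixed-point-free involution,
-- hence |V ∖ C| is even.

module Submission where

open import Defs hiding (sym)
open import Axiom.UniquenessOfIdentityProofs using (module Decidable⇒UIP)
open import Data.Bool as Bool using (false)
open import Data.Empty using (⊥; ⊥-elim)
open import Data.Fin as Fin using (Fin; zero; suc; toℕ; fromℕ; fromℕ<)
import Data.Fin.Properties as Fin
open import Data.Nat as ℕ using (ℕ; zero; suc; _+_; _*_; _<_; ⌊_/2⌋)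
import Data.Nat.Properties as ℕ
open import Data.Product using (Σ; ∃; _×_; _,_; proj₁; proj₂; map₂)
open import Data.Sum using (_⊎_; inj₁; inj₂)
open import Data.Sum.Function.Propositional using (_⊎-↔_)
open import Function.Base using (_∘_)
open import Function.Bundles
  using (_↔_; _⤖_; _⇔_; mk↔ₛ′; mk⤖; mk⇔; Inverse; Injection; Bijection; Equivalence)
open import Function.Construct.Composition using (_↔-∘_)
open import Function.Construct.Symmetry using (↔-sym)
open import Function.Consequences.Propositional using (strictlySurjective⇒surjective)
open import Function.Definitions using (Injective; StrictlySurjective)
import Function.Endo.Propositional as Endo
open import Function.Properties.Inverse using (↔⇒↣; ↔⇒⤖)
open import Relation.Binary.Definitions using (DecidableEquality)
open import Relation.Binary.PropositionalEquality
  using (_≡_; _≢_; refl; sym; trans; cong; cong₂; cong-app; subst; module ≡-Reasoning)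
open import Relation.Nullary using (¬_; yes; no)
open import Relation.Nullary.Decidable using (from-yes; decidable-stable; map′; ¬?; _×-dec_; _⊎-dec_)
open import Relation.Unary using (Decidable)

open ≡-Reasoning

Least : (ℕ → Set) → ℕ → Set
Least P l = P l × (∀ {j} → j < l → ¬ P j)

least-witness : ∀ {P : ℕ → Set} → Decidable P → ∃ P → ∃ (Least P)
least-witness {P} P? (k , Pk)
  with i , ¬¬Pi , above ←
         Fin.¬∀⟶∃¬-smallest (suc k) (λ i → ¬ P (toℕ i)) (λ i → ¬? (P? (toℕ i)))
                            (λ ¬P → ¬P (fromℕ k) (subst P (sym (Fin.toℕ-fromℕ k)) Pk))
  = toℕ i , decidable-stable (P? (toℕ i)) ¬¬Pi , below
  where
  below : ∀ {j} → j < toℕ i → ¬ P j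
  below j<i = subst (¬_ ∘ P) (trans (Fin.toℕ-inject (fromℕ< j<i)) (Fin.toℕ-fromℕ< j<i))
                    (above (fromℕ< j<i))

Least-unique : ∀ {P l l′} → Least P l → Least P l′ → l ≡ l′
Least-unique (Pl , below) (Pl′ , below′) =
  ℕ.≤-antisym (ℕ.≮⇒≥ λ l′<l → below l′<l Pl′) (ℕ.≮⇒≥ λ l<l′ → below′ l<l′ Pl)

Least-cong : ∀ {P Q l} → (∀ k → P k ⇔ Q k) → Least P l → Least Q l
Least-cong P⇔Q (Pl , below) =
  Equivalence.to (P⇔Q _) Pl , λ j<l → below j<l ∘ Equivalence.from (P⇔Q _)

even⊎odd : ∀ k → ∃ λ t → k ≡ t + t ⊎ k ≡ suc (t + t)
even⊎odd zero = 0 , inj₁ refl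
even⊎odd (suc k) with even⊎odd k
... | t , inj₁ k≡t+t = t , inj₂ (cong suc k≡t+t)
... | t , inj₂ k≡1+t+t = suc t , inj₁ (cong suc (trans k≡1+t+t (sym (ℕ.+-suc t t))))

Σ-≡ : ∀ {A : Set} {P : A → Set} → (∀ {x} (p q : P x) → p ≡ q) →
      {u v : Σ A P} → proj₁ u ≡ proj₁ v → u ≡ v
Σ-≡ irrelevant {x , p} {.x , q} refl = cong (x ,_) (irrelevant p q)

Σ-Fin↔Fin : ∀ {n} (P : Fin n → Set) → Decidable P → (∀ {i} (p q : P i) → p ≡ q) →
            ∃ λ m → Σ (Fin n) P ↔ Fin m
Σ-Fin↔Fin {zero} P P? irrelevant =
  0 , mk↔ₛ′ (λ { (() , _) }) (λ ()) (λ ()) (λ { (() , _) })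
Σ-Fin↔Fin {suc n} P P? irrelevant
  with m , tail ← Σ-Fin↔Fin (P ∘ suc) (P? ∘ suc) irrelevant
  with P? zero
... | yes p₀ = suc m , mk↔ₛ′ to from to∘from from∘to
  where
  open Inverse tail renaming (to to to′; from to from′)
  to : Σ (Fin (suc n)) P → Fin (suc m)
  to (zero , _) = zero
  to (suc i , p) = suc (to′ (i , p))
  from : Fin (suc m) → Σ (Fin (suc n)) P
  from zero = zero , p₀
  from (suc k) = suc (proj₁ (from′ k)) , proj₂ (from′ k)
  to∘from : ∀ k → to (from k) ≡ k
  to∘from zero = refl
  to∘from (suc k) = cong suc (strictlyInverseˡ k)
  from∘to : ∀ x → from (to x) ≡ x
  from∘to (zero , p) = cong (zero ,_) (irrelevant p₀ p)
  from∘to (suc i , p) = Σ-≡ irrelevant (cong (suc ∘ proj₁) (strictlyInverseʳ (i , p)))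
... | no ¬p₀ = m , mk↔ₛ′ to from′ strictlyInverseˡ from∘to
  where
  open Inverse tail renaming (to to to′; from to from″)
  to : Σ (Fin (suc n)) P → Fin m
  to (zero , p) = ⊥-elim (¬p₀ p)
  to (suc i , p) = to′ (i , p)
  from′ : Fin m → Σ (Fin (suc n)) P
  from′ k = suc (proj₁ (from″ k)) , proj₂ (from″ k)
  from∘to : ∀ x → from′ (to x) ≡ x
  from∘to (zero , p) = ⊥-elim (¬p₀ p)
  from∘to (suc i , p) = Σ-≡ irrelevant (cong (suc ∘ proj₁) (strictlyInverseʳ (i , p)))

fixedPointFree-involution⇒even : ∀ {m} (τ : Fin m → Fin m) →
                                 (∀ i → τ (τ i) ≡ i) → (∀ i → τ i ≢ i) →
                                 ∃ λ k → Fin m ↔ Fin (2 * k)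
fixedPointFree-involution⇒even {m} τ involutive fixedPointFree =
  let k , lower↔ = Σ-Fin↔Fin Lower (λ i → i Fin.<? τ i) Fin.<-irrelevant
  in k , subst (λ l → Fin m ↔ Fin (k + l)) (sym (ℕ.+-identityʳ k))
               (↔-sym Fin.+↔⊎ ↔-∘ ((lower↔ ⊎-↔ lower↔) ↔-∘ pairs))
  where
  Lower : Fin m → Set
  Lower i = i Fin.< τ i

  τ-lower : ∀ i → ¬ Lower i → Lower (τ i)
  τ-lower i i≮τi = subst (τ i Fin.<_) (sym (involutive i))
    (Fin.≤∧≢⇒< (ℕ.≮⇒≥ i≮τi) (fixedPointFree i))

  pairs : Fin m ↔ (Σ (Fin m) Lower ⊎ Σ (Fin m) Lower)
  pairs = mk↔ₛ′ to from to∘from from∘to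
    where
    to : Fin m → Σ (Fin m) Lower ⊎ Σ (Fin m) Lower
    to i with i Fin.<? τ i
    ... | yes i<τi = inj₁ (i , i<τi)
    ... | no i≮τi = inj₂ (τ i , τ-lower i i≮τi)
    from : Σ (Fin m) Lower ⊎ Σ (Fin m) Lower → Fin m
    from (inj₁ (i , _)) = i
    from (inj₂ (i , _)) = τ i
    from∘to : ∀ i → from (to i) ≡ i
    from∘to i with i Fin.<? τ i
    ... | yes _ = refl
    ... | no _ = involutive i
    to∘from : ∀ x → to (from x) ≡ x
    to∘from (inj₁ (i , i<τi)) with i Fin.<? τ i
    ... | yes _ = cong inj₁ (Σ-≡ Fin.<-irrelevant refl)
    ... | no i≮τi = ⊥-elim (i≮τi i<τi)
    to∘from (inj₂ (i , i<τi)) with τ i Fin.<? τ (τ i)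
    ... | yes τi<ττi = ⊥-elim (Fin.<-asym i<τi (subst (τ i Fin.<_) (involutive i) τi<ττi))
    ... | no _ = cong inj₂ (Σ-≡ Fin.<-irrelevant (involutive i))

module Iterates {V : Set} (f : V → V) where
  open Endo V using (_^_; ^-homo)

  ^-+ : ∀ a b x → (f ^ (a + b)) x ≡ (f ^ a) ((f ^ b) x)
  ^-+ a b = cong-app (^-homo f a b)

  ^-comm : ∀ a b x → (f ^ a) ((f ^ b) x) ≡ (f ^ b) ((f ^ a) x)
  ^-comm a b x = begin
    (f ^ a) ((f ^ b) x) ≡⟨ sym (^-+ a b x) ⟩
    (f ^ (a + b)) x     ≡⟨ cong (λ l → (f ^ l) x) (ℕ.+-comm a b) ⟩
    (f ^ (b + a)) x     ≡⟨ ^-+ b a x ⟩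
    (f ^ b) ((f ^ a) x) ∎

  ^-injective : Injective _≡_ _≡_ f → ∀ k → Injective _≡_ _≡_ (f ^ k)
  ^-injective injective zero e = e
  ^-injective injective (suc k) e = ^-injective injective k (injective e)

module Orbits {V : Set} {m} (finite : V ↔ Fin m)
              (f : V → V) (f-injective : Injective _≡_ _≡_ f) where
  open Endo V using (_^_)
  open Iterates f
  open Inverse finite using (to; from; strictlyInverseˡ; strictlyInverseʳ)

  to-injective : Injective _≡_ _≡_ to
  to-injective = Injection.injective (↔⇒↣ finite)

  _≟_ : DecidableEquality V
  x ≟ y = map′ to-injective (cong to) (to x Fin.≟ to y)

  Returns : V → ℕ → Set
  Returns x k = (f ^ k) x ≡ x

  eventually-returns : ∀ x → ∃ λ k → Returns x (suc k)
  eventually-returns x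
    with i , j , i<j , to-fⁱx≡to-fʲx ← Fin.pigeonhole (ℕ.n<1+n m) (λ i → to ((f ^ toℕ i) x))
    with k , 1+i+k≡j ← ℕ.m≤n⇒∃[o]m+o≡n i<j
    = k , sym (^-injective f-injective (toℕ i) (begin
      (f ^ toℕ i) x               ≡⟨ to-injective to-fⁱx≡to-fʲx ⟩
      (f ^ toℕ j) x               ≡⟨ cong (λ l → (f ^ l) x)
                                         (trans (sym 1+i+k≡j) (sym (ℕ.+-suc (toℕ i) k))) ⟩
      (f ^ (toℕ i + suc k)) x     ≡⟨ ^-+ (toℕ i) (suc k) x ⟩
      (f ^ toℕ i) ((f ^ suc k) x) ∎))

  Returns-along-orbit : ∀ j x k → Returns ((f ^ j) x) k ⇔ Returns x k
  Returns-along-orbit j x k = mk⇔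
    (λ returns → ^-injective f-injective j (trans (^-comm j k x) returns))
    (λ returns → trans (^-comm k j x) (cong (f ^ j) returns))

  firstReturn : ∀ x → ∃ (Least (Returns x ∘ suc))
  firstReturn x = least-witness (λ k → (f ^ suc k) x ≟ x) (eventually-returns x)

  period : V → ℕ
  period x = suc (proj₁ (firstReturn x))

  period-returns : ∀ x → Returns x (period x)
  period-returns x = proj₁ (proj₂ (firstReturn x))

  period-minimal : ∀ x {k} → suc k < period x → ¬ Returns x (suc k)
  period-minimal x k<p = proj₂ (proj₂ (firstReturn x)) (ℕ.s<s⁻¹ k<p)

  period-along-orbit : ∀ j x → period ((f ^ j) x) ≡ period x
  period-along-orbit j x = cong suc (Least-unique
    (Least-cong (Returns-along-orbit j x ∘ suc) (proj₂ (firstReturn ((f ^ j) x))))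
    (proj₂ (firstReturn x)))

  module _ (no-odd-return : ∀ x t → ¬ Returns x (suc (t + t))) where

    half : V → ℕ
    half x = ⌊ period x /2⌋

    period-even : ∀ x → period x ≡ half x + half x
    period-even x with even⊎odd (period x)
    ... | t , inj₂ p≡1+t+t = ⊥-elim (no-odd-return x t (subst (Returns x) p≡1+t+t (period-returns x)))
    ... | t , inj₁ p≡t+t = trans p≡t+t (cong₂ _+_ t≡half t≡half)
      where
      t≡half : t ≡ half x
      t≡half = trans (ℕ.n≡⌊n+n/2⌋ t) (cong ⌊_/2⌋ (sym p≡t+t))

    antipode : V → V
    antipode x = (f ^ half x) x

    antipode-involutive : ∀ x → antipode (antipode x) ≡ x
    antipode-involutive x = begin
      (f ^ half (antipode x)) (antipode x) ≡⟨ cong (λ h → (f ^ h) (antipode x))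
                                                 (cong ⌊_/2⌋ (period-along-orbit (half x) x)) ⟩
      (f ^ half x) ((f ^ half x) x)        ≡⟨ sym (^-+ (half x) (half x) x) ⟩
      (f ^ (half x + half x)) x            ≡⟨ cong (λ l → (f ^ l) x) (sym (period-even x)) ⟩
      (f ^ period x) x                     ≡⟨ period-returns x ⟩
      x                                    ∎

    antipode-fixedPointFree : ∀ x → antipode x ≢ x
    antipode-fixedPointFree x with half x | period-even x
    ... | suc h | p≡h+h = period-minimal x (subst (suc h <_) (sym p≡h+h) (ℕ.m<m+n (suc h) ℕ.z<s))

    even-cardinality : ∃ λ k → V ↔ Fin (2 * k)
    even-cardinality =
      let k , Fin↔ = fixedPointFree-involution⇒even τ τ-involutive τ-fixedPointFree
      in k , Fin↔ ↔-∘ finite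
      where
      τ : Fin m → Fin m
      τ = to ∘ antipode ∘ from
      τ-involutive : ∀ i → τ (τ i) ≡ i
      τ-involutive i = begin
        to (antipode (from (to (antipode (from i))))) ≡⟨ cong (to ∘ antipode) (strictlyInverseʳ _) ⟩
        to (antipode (antipode (from i)))             ≡⟨ cong to (antipode-involutive (from i)) ⟩
        to (from i)                                   ≡⟨ strictlyInverseˡ i ⟩
        i                                             ∎
      τ-fixedPointFree : ∀ i → τ i ≢ i
      τ-fixedPointFree i τi≡i = antipode-fixedPointFree (from i)
        (trans (sym (strictlyInverseʳ _)) (cong from τi≡i))

adjacent⇒distinct : ∀ {V} (G : Graph V) {x y} → Adj G x y → x ≢ y
adjacent⇒distinct G a refl = irrefl G a

module Antimorphism {V : Set} (G : Graph V) (iso : SelfComplementary G) where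
  open Endo V using (_^_)

  σ : V → V
  σ = Bijection.to (proj₁ iso)

  σ-injective : Injective _≡_ _≡_ σ
  σ-injective = Bijection.injective (proj₁ iso)

  open Iterates σ

  σ-reverses-adjacency : ∀ {x y} → Adj G x y → ¬ Adj G (σ x) (σ y)
  σ-reverses-adjacency {x} {y} = proj₂ ∘ Equivalence.to (proj₂ iso x y)

  σ-reflects-nonadjacency : ∀ {x y} → x ≢ y → ¬ Adj G (σ x) (σ y) → Adj G x y
  σ-reflects-nonadjacency {x} {y} x≢y ¬a =
    Equivalence.from (proj₂ iso x y) ((x≢y ∘ σ-injective) , ¬a)

  no-odd-return : ∀ {u} → σ u ≢ u → ∀ t → (σ ^ suc (t + t)) u ≢ u
  no-odd-return {u} σu≢u t returns = ¬A₀ A₀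
    where
    A : ℕ → Set
    A j = Adj G ((σ ^ j) u) ((σ ^ suc j) u)

    consecutive-distinct : ∀ j → (σ ^ j) u ≢ (σ ^ suc j) u
    consecutive-distinct j e = σu≢u (sym (^-injective σ-injective j (trans e (^-comm 1 j u))))

    alternate : ∀ j → A j → ¬ A (suc j)
    alternate j = σ-reverses-adjacency

    alternate⁻ : ∀ j → ¬ A (suc j) → A j
    alternate⁻ j = σ-reflects-nonadjacency (consecutive-distinct j)

    forth : ∀ t → A 0 → A (t + t)
    forth zero a = a
    forth (suc t) a = subst A (cong suc (sym (ℕ.+-suc t t)))
      (alternate⁻ (2 + t + t) λ a₃ → alternate (t + t) (forth t a)
        (alternate⁻ (suc (t + t)) λ a₂ → alternate (2 + t + t) a₂ a₃))

    back : ∀ t → A (t + t) → A 0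
    back zero a = a
    back (suc t) a = back t (alternate⁻ (t + t) λ a₁ →
      alternate (suc (t + t)) a₁ (subst A (cong suc (ℕ.+-suc t t)) a))

    A-last⇒A₀ : A (suc (t + t)) → A 0
    A-last⇒A₀ = subst (λ v → Adj G v (σ v)) returns

    A₀⇒A-last : A 0 → A (suc (t + t))
    A₀⇒A-last = subst (λ v → Adj G v (σ v)) (sym returns)

    ¬A₀ : ¬ A 0
    ¬A₀ a = alternate (t + t) (forth t a) (A₀⇒A-last a)

    A₀ : A 0
    A₀ = back t (alternate⁻ (t + t) (¬A₀ ∘ A-last⇒A₀))

Cyclic : Fin 5 → Fin 5 → Set
Cyclic i j = j ≡ suc5 i ⊎ i ≡ suc5 j

two-apart : ∀ i → i ≢ suc5 (suc5 i) × ¬ Cyclic i (suc5 (suc5 i))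
two-apart = from-yes (Fin.all? λ i →
  ¬? (i Fin.≟ suc5 (suc5 i)) ×-dec
  ¬? ((suc5 (suc5 i) Fin.≟ suc5 i) ⊎-dec (i Fin.≟ suc5 (suc5 (suc5 i)))))

suc5-surjective : ∀ i → ∃ λ j → suc5 j ≡ i
suc5-surjective = from-yes (Fin.all? λ i → Fin.any? λ j → suc5 j Fin.≟ i)

preserves-image⇒preserves-complement :
  ∀ {V : Set} {k} (c : Fin k → V) → Injective _≡_ _≡_ c →
  (σ : V → V) → Injective _≡_ _≡_ σ → (∀ i → ∃ λ j → σ (c i) ≡ c j) →
  ∀ {v} → (∀ i → c i ≢ v) → ∀ j → σ v ≢ c j
preserves-image⇒preserves-complement {k = k} c c-injective σ σ-injective image {v} v∉image j σv≡cj =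
  Fin.<⇒notInjective (ℕ.n<1+n k) g-injective
  where
  g : Fin (suc k) → Fin k
  g zero = j
  g (suc i) = proj₁ (image i)

  σ∘c≡c∘g : ∀ i → σ (c i) ≡ c (g (suc i))
  σ∘c≡c∘g i = proj₂ (image i)

  cj≢c∘g : ∀ i → c j ≢ c (g (suc i))
  cj≢c∘g i e = v∉image i (sym (σ-injective (trans σv≡cj (trans e (sym (σ∘c≡c∘g i))))))

  g-injective : Injective _≡_ _≡_ g
  g-injective {zero} {zero} _ = refl
  g-injective {zero} {suc i} e = ⊥-elim (cj≢c∘g i (cong c e))
  g-injective {suc i} {zero} e = ⊥-elim (cj≢c∘g i (cong c (sym e)))
  g-injective {suc i} {suc i′} e = cong suc (c-injective (σ-injective
    (trans (σ∘c≡c∘g i) (trans (cong c e) (sym (σ∘c≡c∘g i′))))))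

isC≡false⇒≢inC : ∀ p → isC p ≡ false → p ≢ inC
isC≡false⇒≢inC inC () refl

≢inC⇒isC≡false : ∀ p → p ≢ inC → isC p ≡ false
≢inC⇒isC≡false inK _ = refl
≢inC⇒isC≡false inI _ = refl
≢inC⇒isC≡false inC p≢inC = ⊥-elim (p≢inC refl)

module _ {V : Set} {G : Graph V} (P : PseudoSplitPartition G) where
  open PseudoSplitPartition P

  DeleteC-≡ : {x y : DeleteC P} → proj₁ x ≡ proj₁ y → x ≡ y
  DeleteC-≡ = Σ-≡ (Decidable⇒UIP.≡-irrelevant Bool._≟_)

  minusC-split : IsSplit (minusC G P)
  minusC-split = (In part inK ∘ proj₁) , (In part inI ∘ proj₁) , K⊎I , K∩I ,
    (λ u v u∈K v∈K u≢v → K-clique _ _ u∈K v∈K (u≢v ∘ DeleteC-≡)) ,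
    (λ u v → I-independent _ _)
    where
    K⊎I : ∀ x → In part inK (proj₁ x) ⊎ In part inI (proj₁ x)
    K⊎I (v , v∉C) with part v in eq
    ... | inK = inj₁ refl
    ... | inI = inj₂ refl
    ... | inC = ⊥-elim (isC≡false⇒≢inC (part v) v∉C eq)
    K∩I : ∀ x → In part inK (proj₁ x) → In part inI (proj₁ x) → ⊥
    K∩I _ v∈K v∈I with () ← trans (sym v∈K) v∈I

module FiveCycleComponent {V : Set} {G : Graph V} (P : PseudoSplitPartition G) (iso : SelfComplementary G)
                          (C₅ : InducesC5 G (In (PseudoSplitPartition.part P) inC)) where
  open PseudoSplitPartition P
  open Antimorphism G iso

  c : Fin 5 → V
  c = proj₁ C₅

  c-injective : Injective _≡_ _≡_ c
  c-injective = proj₁ (proj₂ C₅)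

  C⇔image : ∀ v → In part inC v ⇔ (∃ λ i → c i ≡ v)
  C⇔image = proj₁ (proj₂ (proj₂ C₅))

  c-adjacent⇔Cyclic : ∀ i j → Adj G (c i) (c j) ⇔ Cyclic i j
  c-adjacent⇔Cyclic = proj₂ (proj₂ (proj₂ C₅))

  c∈C : ∀ i → In part inC (c i)
  c∈C i = Equivalence.from (C⇔image (c i)) (i , refl)

  σc-nonadjacent : ∀ {i j} → Cyclic i j → ¬ Adj G (σ (c i)) (σ (c j))
  σc-nonadjacent {i} {j} = σ-reverses-adjacency ∘ Equivalence.from (c-adjacent⇔Cyclic i j)

  σc-two-apart : ∀ i → ¬ ¬ Adj G (σ (c i)) (σ (c (suc5 (suc5 i))))
  σc-two-apart i ¬a = proj₂ (two-apart i) (Equivalence.to (c-adjacent⇔Cyclic _ _)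
    (σ-reflects-nonadjacency (proj₁ (two-apart i) ∘ c-injective) ¬a))

  K-cycle-neighbour-in-I : ∀ {i j} → Cyclic i j → part (σ (c i)) ≡ inK → part (σ (c j)) ≡ inI
  K-cycle-neighbour-in-I {i} {j} ij σci∈K with part (σ (c j)) in σcj∈
  ... | inI = refl
  ... | inK = ⊥-elim (σc-nonadjacent ij (K-clique _ _ σci∈K σcj∈
                (adjacent⇒distinct G (Equivalence.from (c-adjacent⇔Cyclic i j) ij) ∘ σ-injective)))
  ... | inC = ⊥-elim (σc-nonadjacent ij (Graph.sym G (C-complete-K _ _ σcj∈ σci∈K)))

  σc∉K : ∀ i → part (σ (c i)) ≢ inK
  σc∉K i σci∈K with j , refl ← suc5-surjective i =
    σc-two-apart j (I-independent _ _ (K-cycle-neighbour-in-I (inj₂ refl) σci∈K)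
                                      (K-cycle-neighbour-in-I (inj₁ refl) σci∈K))

  σc∉I : ∀ i → part (σ (c i)) ≢ inI
  σc∉I i σci∈I with part (σ (c (suc5 (suc5 i)))) in σc₂∈
  ... | inI = σc-two-apart i (I-independent _ _ σci∈I σc₂∈)
  ... | inK = σc∉K _ σc₂∈
  ... | inC = σc-two-apart i (C-anticomplete-I _ _ σc₂∈ σci∈I ∘ Graph.sym G)

  σc∈C : ∀ i → In part inC (σ (c i))
  σc∈C i with part (σ (c i)) in σci∈
  ... | inC = refl
  ... | inK = ⊥-elim (σc∉K i σci∈)
  ... | inI = ⊥-elim (σc∉I i σci∈)

  σ-preserves-C : ∀ {v} → In part inC v → In part inC (σ v)
  σ-preserves-C {v} v∈C with i , refl ← Equivalence.to (C⇔image v) v∈C = σc∈C i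

  σ-preserves-outside-C : ∀ {v} → part v ≢ inC → part (σ v) ≢ inC
  σ-preserves-outside-C {v} v∉C σv∈C =
    let j , cj≡σv = Equivalence.to (C⇔image (σ v)) σv∈C
    in preserves-image⇒preserves-complement c c-injective σ σ-injective
         (λ i → map₂ sym (Equivalence.to (C⇔image _) (σc∈C i)))
         (λ i ci≡v → v∉C (subst (In part inC) ci≡v (c∈C i)))
         j (sym cj≡σv)

  σ-fixes-no-vertex-outside-C : ∀ {u} → part u ≢ inC → σ u ≢ u
  σ-fixes-no-vertex-outside-C {u} u∉C σu≡u with part u in u∈
  ... | inC = u∉C refl
  ... | inK = σ-reverses-adjacency (C-complete-K _ _ (c∈C zero) u∈)
                (subst (Adj G (σ (c zero))) (sym σu≡u) (C-complete-K _ _ (σc∈C zero) u∈))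
  ... | inI = C-anticomplete-I _ _ (c∈C zero) u∈
                (σ-reflects-nonadjacency c₀≢u
                  (subst (¬_ ∘ Adj G (σ (c zero))) (sym σu≡u) (C-anticomplete-I _ _ (σc∈C zero) u∈)))
    where
    c₀≢u : c zero ≢ u
    c₀≢u refl with () ← trans (sym (c∈C zero)) u∈

  module EV = Endo V
  module ED = Endo (DeleteC P)

  ρ : DeleteC P → DeleteC P
  ρ (v , v∉C) = σ v , ≢inC⇒isC≡false _ (σ-preserves-outside-C (isC≡false⇒≢inC _ v∉C))

  ρ-injective : Injective _≡_ _≡_ ρ
  ρ-injective = DeleteC-≡ P ∘ σ-injective ∘ cong proj₁

  ρ-strictlySurjective : StrictlySurjective _≡_ ρ
  ρ-strictlySurjective (w , w∉C) =
    let v , σv≡w = Bijection.strictlySurjective (proj₁ iso) w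
        v∉C = ≢inC⇒isC≡false _ λ v∈C →
                isC≡false⇒≢inC _ w∉C (subst (In part inC) σv≡w (σ-preserves-C v∈C))
    in (v , v∉C) , DeleteC-≡ P σv≡w

  ρ-bijection : DeleteC P ⤖ DeleteC P
  ρ-bijection = mk⤖ (ρ-injective , strictlySurjective⇒surjective ρ-strictlySurjective)

  minusC-selfComplementary : SelfComplementary (minusC G P)
  minusC-selfComplementary = ρ-bijection , λ x y → mk⇔
    (λ a → let x≢y , ¬σa = Equivalence.to (proj₂ iso (proj₁ x) (proj₁ y)) a
           in (x≢y ∘ cong proj₁) , ¬σa)
    (λ (ρx≢ρy , ¬σa) → Equivalence.from (proj₂ iso (proj₁ x) (proj₁ y))
           ((ρx≢ρy ∘ DeleteC-≡ P) , ¬σa))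

  ρ^-proj₁ : ∀ k x → proj₁ ((ρ ED.^ k) x) ≡ (σ EV.^ k) (proj₁ x)
  ρ^-proj₁ zero x = refl
  ρ^-proj₁ (suc k) x = cong σ (ρ^-proj₁ k x)

  ρ-no-odd-return : ∀ x t → (ρ ED.^ suc (t + t)) x ≢ x
  ρ-no-odd-return (v , v∉C) t returns =
    no-odd-return (σ-fixes-no-vertex-outside-C (isC≡false⇒≢inC _ v∉C)) t
      (trans (sym (ρ^-proj₁ (suc (t + t)) (v , v∉C))) (cong proj₁ returns))

DeleteC-hasEvenOrder : ∀ {n} {G : Graph (Fin n)} (P : PseudoSplitPartition G) → SelfComplementary G →
                       InducesC5 G (In (PseudoSplitPartition.part P) inC) → HasEvenOrder (DeleteC P)
DeleteC-hasEvenOrder P iso C₅ =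
  let _ , finite = Σ-Fin↔Fin (λ v → isC (part v) ≡ false) (λ v → isC (part v) Bool.≟ false)
                             (Decidable⇒UIP.≡-irrelevant Bool._≟_)
      k , D↔ = Orbits.even-cardinality finite ρ ρ-injective ρ-no-odd-return
  in k , ↔⇒⤖ D↔
  where
  open PseudoSplitPartition P
  open FiveCycleComponent P iso C₅

nonempty-C⇒C₅ : ∀ {V} {G : Graph V} (P : PseudoSplitPartition G) → let open PseudoSplitPartition P in
                (∃ λ v → part v ≡ inC) → InducesC5 G (In part inC)
nonempty-C⇒C₅ P (v , v∈C) with PseudoSplitPartition.C-shape P
... | inj₁ C≡∅ = ⊥-elim (C≡∅ v v∈C)
... | inj₂ C₅ = C₅

proposition7 : ∀ {n : ℕ} (G : Graph (Fin n)) (P : PseudoSplitPartition G) →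
    SelfComplementary G →
    (∃ λ v → PseudoSplitPartition.part P v ≡ inC) →
    SelfComplementary (minusC G P) × IsSplit (minusC G P) × HasEvenOrder (DeleteC P)
proposition7 G P iso C≢∅ =
  FiveCycleComponent.minusC-selfComplementary P iso C₅ , minusC-split P , DeleteC-hasEvenOrder P iso C₅
  where
  C₅ : InducesC5 G (In (PseudoSplitPartition.part P) inC)
  C₅ = nonempty-C⇒C₅ P C≢∅
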